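{- Let $\Gamma \Rightarrow F$ be a $\rightarrow$-sequent which is binary and tautological. Let $\Delta$ be the multiset obtained from $\Gamma$ by deleting all irrelevant formulas of the sequent $\Gamma\Rightarrow F$. Then the sequent $\Delta\Rightarrow F$ is tautological (and it is binary).
   Context: Fix a language with infinitely many propositional atoms. A $\rightarrow$-formula is built from atoms using only the binary connective $\rightarrow$. A $\rightarrow$-sequent is a pair $\Gamma\Rightarrow F$ where $\Gamma$ (the antecedent) is a finite multiset of $\rightarrow$-formulas and $F$ (the succedent) is a $\rightarrow$-formula. A sequent $E_1,\ldots,E_n\Rightarrow F$ is identified with the classical propositional formula $E_1\wedge\cdots\wedge E_n\rightarrow F$ (with $\rightarrow$ read as classical implication); it is tautological iff this formula is a classical tautology, and binary iff no atom occurs in it more than twice. The head of a $\rightarrow$-formula is defined by: an atom is its own head; the head of $E\rightarrow F$ is the head of $F$. For a binary sequent $\Gamma\Rightarrow F$, the relevant formulas are the elements (occurrences) of the smallest collection $S$ of members of $\Gamma$ such that: (1) every member of $\Gamma$ whose head occurs in $F$ is in $S$; (2) every member of $\Gamma$ whose head occurs in some element of $S$ is in $S$. Members of $\Gamma$ that are not relevant are called irrelevant. -}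

module Defs where

open import Data.Nat using (ℕ; zero; suc; _+_; _≤_)
open import Data.Nat using (_≡ᵇ_)
open import Data.Bool using (Bool; true; false; _∧_; not; _∨_; if_then_else_)
open import Data.List using (List; []; _∷_; length; lookup)
open import Data.Fin using (Fin) renaming (zero to fzero; suc to fsuc)
open import Data.Product using (_×_)
open import Relation.Binary.PropositionalEquality using (_≡_)

data Formula : Set where
  atom : ℕ → Formula
  _⇒_  : Formula → Formula → Formula

infixr 5 _⇒_

-- A sequent Γ ⇒ F: antecedent a finite multiset (represented as a list;
-- all notions below are invariant under permutation), succedent a formula.
record Sequent : Set where
  constructor _⊢_
  field
    ant : List Formula
    succedent : Formula

eval : (ℕ → Bool) → Formula → Bool
eval v (atom a) = v a
eval v (E ⇒ F)  = not (eval v E) ∨ eval v F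

evalAll : (ℕ → Bool) → List Formula → Bool
evalAll v []       = true
evalAll v (E ∷ Γ)  = eval v E ∧ evalAll v Γ

Tautological : Sequent → Set
Tautological (Γ ⊢ F) = ∀ (v : ℕ → Bool) → evalAll v Γ ≡ true → eval v F ≡ true

occ : ℕ → Formula → ℕ
occ a (atom b) = if a ≡ᵇ b then 1 else 0
occ a (E ⇒ F)  = occ a E + occ a F

occList : ℕ → List Formula → ℕ
occList a []      = 0
occList a (E ∷ Γ) = occ a E + occList a Γ

Binary : Sequent → Set
Binary (Γ ⊢ F) = ∀ (a : ℕ) → occList a Γ + occ a F ≤ 2

head : Formula → ℕ
head (atom a) = a
head (E ⇒ F)  = head F

OccursIn : ℕ → Formula → Set
OccursIn a F = 1 ≤ occ a F

-- Relevant members (occurrences, indexed by position in Γ) of Γ ⇒ F: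
-- the least collection S satisfying (1) and (2) of the definition.
data Relevant (Γ : List Formula) (F : Formula) : Fin (length Γ) → Set where
  base : ∀ {i} → OccursIn (head (lookup Γ i)) F → Relevant Γ F i
  step : ∀ {i j} → Relevant Γ F j → OccursIn (head (lookup Γ i)) (lookup Γ j)
       → Relevant Γ F i

select : (Γ : List Formula) → (Fin (length Γ) → Bool) → List Formula
select []      m = []
select (E ∷ Γ) m = if m fzero then E ∷ select Γ (λ i → m (fsuc i))
                   else select Γ (λ i → m (fsuc i))

-- Δ: delete all irrelevant formulas of Γ ⇒ F.  A mask characterising
-- the relevant positions exactly is required (relevance is defined as
-- the least fixed point, stated inductively).
RelevanceMask : (Γ : List Formula) (F : Formula) → (Fin (length Γ) → Bool) → Set
RelevanceMask Γ F m = ∀ i → (m i ≡ true → Relevant Γ F i) × (Relevant Γ F i → m i ≡ true)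

-- If v satisfies Δ, let w agree with v on the atoms of Δ ⇒ F and be true
-- elsewhere.  An irrelevant member of Γ has its head outside those atoms (else it
-- would be relevant), so w makes its head, hence the formula, true; the relevant
-- members and F mention only atoms on which w = v.  So w satisfies Γ, hence F,
-- hence v satisfies F.
module Submission where

open import Defs
open import Data.Bool using (Bool; true; false; _∨_; not; if_then_else_)
open import Data.Bool.Properties using (∨-zeroʳ)
open import Data.Fin using (Fin) renaming (zero to fzero; suc to fsuc)
open import Data.List using (List; []; _∷_; length; lookup)
open import Data.List.Membership.Propositional using (_∈_; find; lose)
open import Data.List.Relation.Unary.All as All using (All; []; _∷_)
open import Data.List.Relation.Unary.Any using (Any; here; there; any?)
open import Data.Nat using (ℕ; _≤_; _≤?_; _≡ᵇ_)
open import Data.Nat.Properties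
  using (≡⇒≡ᵇ; ≤-refl; ≤-trans; m≤m+n; m≤n+m; +-monoʳ-≤; +-monoˡ-≤)
open import Data.Product using (_×_; _,_; ∃; proj₁; proj₂)
open import Data.Sum using (_⊎_; inj₁; inj₂)
open import Function using (case_of_)
open import Relation.Nullary using (Dec; ¬_; does)
open import Relation.Nullary.Decidable using (dec-true; dec-false; _⊎-dec_)
open import Relation.Binary.PropositionalEquality using (_≡_; refl; sym; trans; cong₂; module ≡-Reasoning)
open ≡-Reasoning

occurs? : ∀ a G → Dec (OccursIn a G)
occurs? a G = 1 ≤? occ a G

atom-occurs : ∀ a → OccursIn a (atom a)
atom-occurs a with a ≡ᵇ a | ≡⇒≡ᵇ a a refl
... | true | _ = ≤-refl

eval-cong : ∀ {v w} G → (∀ {a} → OccursIn a G → v a ≡ w a) → eval v G ≡ eval w G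
eval-cong (atom a) v≗w = v≗w (atom-occurs a)
eval-cong (E ⇒ G)  v≗w = cong₂ (λ x y → not x ∨ y)
  (eval-cong E (λ p → v≗w (≤-trans p (m≤m+n _ _))))
  (eval-cong G (λ p → v≗w (≤-trans p (m≤n+m _ _))))

eval-head : ∀ v G → v (head G) ≡ true → eval v G ≡ true
eval-head v (atom a) va = va
eval-head v (E ⇒ G)  vh with eval v G | eval-head v G vh
... | true | _ = ∨-zeroʳ _

evalAll⇒All : ∀ v Γ → evalAll v Γ ≡ true → All (λ G → eval v G ≡ true) Γ
evalAll⇒All v []      _ = []
evalAll⇒All v (E ∷ Γ) h with eval v E in vE
... | true = vE ∷ evalAll⇒All v Γ h

evalAll-lookup : ∀ v Γ → (∀ i → eval v (lookup Γ i) ≡ true) → evalAll v Γ ≡ true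
evalAll-lookup v []      _ = refl
evalAll-lookup v (E ∷ Γ) h with eval v E | h fzero
... | true | _ = evalAll-lookup v Γ (λ i → h (fsuc i))

select-∈⁺ : ∀ Γ m {i} → m i ≡ true → lookup Γ i ∈ select Γ m
select-∈⁺ (E ∷ Γ) m {fzero}  mi with m fzero
... | true = here refl
select-∈⁺ (E ∷ Γ) m {fsuc i} mi with m fzero
... | true  = there (select-∈⁺ Γ (λ j → m (fsuc j)) mi)
... | false = select-∈⁺ Γ (λ j → m (fsuc j)) mi

select-∈⁻ : ∀ Γ m {G} → G ∈ select Γ m → ∃ λ i → m i ≡ true × lookup Γ i ≡ G
select-∈⁻ (E ∷ Γ) m G∈ with m fzero in m0
select-∈⁻ (E ∷ Γ) m (here refl) | true = fzero , m0 , refl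
select-∈⁻ (E ∷ Γ) m (there G∈)  | true with select-∈⁻ Γ (λ j → m (fsuc j)) G∈
... | i , mi , eq = fsuc i , mi , eq
select-∈⁻ (E ∷ Γ) m G∈          | false with select-∈⁻ Γ (λ j → m (fsuc j)) G∈
... | i , mi , eq = fsuc i , mi , eq

occList-select-≤ : ∀ a Γ m → occList a (select Γ m) ≤ occList a Γ
occList-select-≤ a []      m = ≤-refl
occList-select-≤ a (E ∷ Γ) m with m fzero
... | true  = +-monoʳ-≤ (occ a E) (occList-select-≤ a Γ (λ j → m (fsuc j)))
... | false = ≤-trans (occList-select-≤ a Γ (λ j → m (fsuc j))) (m≤n+m _ (occ a E))

select-binary : ∀ Γ F m → Binary (Γ ⊢ F) → Binary (select Γ m ⊢ F)
select-binary Γ F m bin a = ≤-trans (+-monoˡ-≤ (occ a F) (occList-select-≤ a Γ m)) (bin a)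

OccursInSequent : ℕ → Sequent → Set
OccursInSequent a (Δ ⊢ F) = OccursIn a F ⊎ Any (OccursIn a) Δ

occursInSequent? : ∀ a S → Dec (OccursInSequent a S)
occursInSequent? a (Δ ⊢ F) = occurs? a F ⊎-dec any? (occurs? a) Δ

trueOutside : Sequent → (ℕ → Bool) → ℕ → Bool
trueOutside S v a = if does (occursInSequent? a S) then v a else true

trueOutside-inside : ∀ S v {a} → OccursInSequent a S → v a ≡ trueOutside S v a
trueOutside-inside S v {a} p rewrite dec-true (occursInSequent? a S) p = refl

trueOutside-outside : ∀ S v {a} → ¬ OccursInSequent a S → trueOutside S v a ≡ true
trueOutside-outside S v {a} ¬p rewrite dec-false (occursInSequent? a S) ¬p = refl

HeadClosed : (Γ : List Formula) → Formula → (Fin (length Γ) → Bool) → Set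
HeadClosed Γ F m = ∀ i → OccursInSequent (head (lookup Γ i)) (select Γ m ⊢ F) → m i ≡ true

select-tautological : ∀ Γ F m → HeadClosed Γ F m →
  Tautological (Γ ⊢ F) → Tautological (select Γ m ⊢ F)
select-tautological Γ F m closed taut v vΔ = begin
  eval v F ≡⟨ eval-cong F (λ p → trueOutside-inside S v (inj₁ p)) ⟩
  eval w F ≡⟨ taut w (evalAll-lookup w Γ wΓ) ⟩
  true     ∎
  where
  S = select Γ m ⊢ F
  w = trueOutside S v

  wΓ : ∀ i → eval w (lookup Γ i) ≡ true
  wΓ i with m i in mi
  ... | true = begin
    eval w (lookup Γ i) ≡⟨ eval-cong (lookup Γ i) (λ p → trueOutside-inside S v (inj₂ (lose Γi∈Δ p))) ⟨
    eval v (lookup Γ i) ≡⟨ All.lookup (evalAll⇒All v _ vΔ) Γi∈Δ ⟩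
    true                ∎
    where Γi∈Δ = select-∈⁺ Γ m mi
  ... | false = eval-head w (lookup Γ i) (trueOutside-outside S v headOutside)
    where
    headOutside : ¬ OccursInSequent (head (lookup Γ i)) S
    headOutside p = case trans (sym mi) (closed i p) of λ ()

relevanceMask-headClosed : ∀ Γ F m → RelevanceMask Γ F m → HeadClosed Γ F m
relevanceMask-headClosed Γ F m rm i (inj₁ inF) = proj₂ (rm i) (base inF)
relevanceMask-headClosed Γ F m rm i (inj₂ inΔ) with find inΔ
... | G , G∈Δ , inG with select-∈⁻ Γ m G∈Δ
... | j , mj , refl = proj₂ (rm i) (step (proj₁ (rm j) mj) inG)

lemma4p1 : (Γ : List Formula) (F : Formula) →
    Binary (Γ ⊢ F) → Tautological (Γ ⊢ F) →
    (m : Fin (length Γ) → Bool) → RelevanceMask Γ F m →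
    Tautological (select Γ m ⊢ F) × Binary (select Γ m ⊢ F)
lemma4p1 Γ F bin taut m rm =
  select-tautological Γ F m (relevanceMask-headClosed Γ F m rm) taut ,
  select-binary Γ F m bin
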